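{- Let $r$ be a complex number and $n\ge1$ an integer. Then, as polynomials in $x$, $$\sum_{k=0}^{n-1}\prod_{s=k+1}^n s(s+2r)\, D_k^{(r)}(x)^2=n(n+2r)\Big(D_{n-1}^{(r)}(x)\frac{d}{dx}D_n^{(r)}(x)-D_n^{(r)}(x)\frac{d}{dx}D_{n-1}^{(r)}(x)\Big)$$ and $$\sum_{k=0}^{n-1}(-1)^k\prod_{s=k+1}^n\frac{s+2r}{s}\, d_k^{(r)}(x)^2=(-1)^{n-1}\frac{n+2r}{2}\Big(d_{n-1}^{(r)}(x)\frac{d}{dx}d_n^{(r)}(x)-d_n^{(r)}(x)\frac{d}{dx}d_{n-1}^{(r)}(x)\Big).$$
   Context: For a complex number $a$ and integer $k\ge0$, $\binom{a}{k}=a(a-1)\cdots(a-k+1)/k!$. For a parameter $r$ and an integer $n\ge 0$, $d_n^{(r)}(x)=\sum_{k=0}^n\binom{x+r+k}{k}\binom{x-r}{n-k}$. The polynomials $D_n^{(r)}(x)$ are defined by $D_{ -1}^{(r)}(x)=0$, $D_0^{(r)}(x)=1$ and $D_{n+1}^{(r)}(x)=xD_n^{(r)}(x)-n(n+2r)D_{n-1}^{(r)}(x)$ for $n\ge0$. -}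

module Defs where

open import Level using (Level; _⊔_) renaming (suc to lsuc)
open import Data.Nat using (ℕ; zero; suc; _∸_; _!)
open import Relation.Nullary using (¬_)
open import Algebra.Bundles using (CommutativeRing)

-- A field of characteristic zero (the paper works over ℂ, which is not
-- available in agda-stdlib; ℂ is an instance of this notion).

module _ {c ℓ} (R : CommutativeRing c ℓ) where
  open CommutativeRing R
  ι : ℕ → Carrier
  ι zero = 0#
  ι (suc n) = 1# + ι n

record CharZeroField c ℓ : Set (lsuc (c ⊔ ℓ)) where
  field
    cring : CommutativeRing c ℓ
  open CommutativeRing cring public
  field
    _⁻¹        : Carrier → Carrier
    ⁻¹-inverse : ∀ x → ¬ (x ≈ 0#) → x * (x ⁻¹) ≈ 1#
    char0      : ∀ n → ¬ (ι cring (suc n) ≈ 0#)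

-- Polynomials in x over F, represented inside the formal power series
-- ring F[[x]] by their coefficient sequences (coefficient of x^i).
-- Equality of polynomials = equality of all coefficients.

module Poly {c ℓ} (F : CharZeroField c ℓ) where
  open CharZeroField F

  n̂ : ℕ → Carrier
  n̂ = ι cring

  sumK : ℕ → (ℕ → Carrier) → Carrier
  sumK zero    g = 0#
  sumK (suc m) g = sumK m g + g m

  prodK : ℕ → (ℕ → Carrier) → Carrier
  prodK zero    g = 1#
  prodK (suc m) g = prodK m g * g m

  sign : ℕ → Carrier
  sign zero    = 1#
  sign (suc k) = - sign k

  Pol : Set c
  Pol = ℕ → Carrier

  _≋_ : Pol → Pol → Set ℓ
  p ≋ q = ∀ i → p i ≈ q i

  const : Carrier → Pol
  const a zero    = a
  const a (suc i) = 0#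

  X : Pol
  X zero          = 0#
  X (suc zero)    = 1#
  X (suc (suc i)) = 0#

  _⊕_ : Pol → Pol → Pol
  (p ⊕ q) i = p i + q i

  _⊖_ : Pol → Pol → Pol
  (p ⊖ q) i = p i + - q i

  _·_ : Carrier → Pol → Pol
  (a · p) i = a * p i

  _⊗_ : Pol → Pol → Pol
  (p ⊗ q) i = sumK (suc i) (λ j → p j * q (i ∸ j))

  deriv : Pol → Pol
  deriv p i = n̂ (suc i) * p (suc i)

  sumP : ℕ → (ℕ → Pol) → Pol
  sumP zero    f = const 0#
  sumP (suc m) f = sumP m f ⊕ f m

  prodP : ℕ → (ℕ → Pol) → Pol
  prodP zero    f = const 1#
  prodP (suc m) f = prodP m f ⊗ f m

  binom : Pol → ℕ → Pol
  binom a k = (n̂ (k !) ⁻¹) · prodP k (λ j → a ⊖ const (n̂ j))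

  d : Carrier → ℕ → Pol
  d r n = sumP (suc n) (λ k →
            binom (X ⊕ const (r + n̂ k)) k ⊗ binom (X ⊖ const r) (n ∸ k))

  -- D_0 = 1, D_1 = x D_0 - 0·D_{-1} = x,
  -- D_{n+1} = x D_n - n(n+2r) D_{n-1}
  D : Carrier → ℕ → Pol
  D r zero          = const 1#
  D r (suc zero)    = X
  D r (suc (suc n)) =
    (X ⊗ D r (suc n)) ⊖ ((n̂ (suc n) * (n̂ (suc n) + (r + r))) · D r n)

{-# OPTIONS --safe #-}
module Submission where

-- Both identities are confluent Christoffel–Darboux sums. For any derivation δ of a commutative ring
-- and the Wronskian W(p, q) = p δq − q δp, a three-term recurrence A p₂ = L p₁ + B p₀ with δA = δB = 0
-- gives A W(p₁, p₂) = δL p₁² − B W(p₀, p₁). This first-order recurrence for the Wronskians of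
-- consecutive terms telescopes against the weights ∏ s(s+2r), resp. ∏ (s+2r)/s, so both identities
-- follow by induction on n. For D the recurrence is the definition (A = 1, L = x, B = −n(n+2r)). For d
-- it is (n+2) d_{n+2} = (2x+1) d_{n+1} + (n+1+2r) d_n: d_n is the convolution Σ u_k v_{n−k} of
-- u_k = binom(x+r+k, k) and v_m = binom(x−r, m), whose terms satisfy (k+1) u_{k+1} = (x+r+1+k) u_k and
-- (m+1) v_{m+1} = (x−r−m) v_m, so splitting the factor n+1 = (k+1) + (n−k) in (n+1) d_{n+1} expresses
-- it through d_n, and doing this twice yields the recurrence.

open import Defs
open import Level using (_⊔_)
open import Algebra.Bundles using (CommutativeRing)
open import Data.Nat using (ℕ; zero; suc; _∸_; _≤_; _<_; _!) renaming (_+_ to _+ℕ_; _*_ to _*ℕ_)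
import Data.Nat.Properties as ℕ
open import Data.Integer as ℤ using (ℤ; +_; -[1+_]; _◃_; ∣_∣)
import Data.Integer.Properties as ℤ
open import Data.Sign as Sign using (Sign)
open import Data.Product using (_×_; _,_)
import Data.Maybe as Maybe
open import Relation.Nullary using (¬_)
open import Relation.Nullary.Decidable using (dec⇒maybe)
import Relation.Binary.PropositionalEquality as ≡
import Relation.Binary.Reasoning.Setoid as SetoidReasoning
open import Algebra.Solver.Ring.AlmostCommutativeRing
  using (fromCommutativeRing; _-Raw-AlmostCommutative⟶_)
import Algebra.Solver.Ring as RingSolver
import Algebra.Properties.Ring as RingProperties
import Algebra.Properties.CommutativeSemigroup as CommutativeSemigroupProperties

module Numerals {c ℓ} (R : CommutativeRing c ℓ) where
  open CommutativeRing R
  open SetoidReasoning setoid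

  ι-+ : ∀ m n → ι R (m +ℕ n) ≈ ι R m + ι R n
  ι-+ zero    n = sym (+-identityˡ _)
  ι-+ (suc m) n = trans (+-cong refl (ι-+ m n)) (sym (+-assoc _ _ _))

  ι-* : ∀ m n → ι R (m *ℕ n) ≈ ι R m * ι R n
  ι-* zero    n = sym (zeroˡ _)
  ι-* (suc m) n = begin
    ι R (n +ℕ m *ℕ n)           ≈⟨ ι-+ n (m *ℕ n) ⟩
    ι R n + ι R (m *ℕ n)        ≈⟨ +-cong (sym (*-identityˡ _)) (ι-* m n) ⟩
    1# * ι R n + ι R m * ι R n  ≈⟨ sym (distribʳ _ _ _) ⟩
    (1# + ι R m) * ι R n        ∎

  ι-∸ : ∀ {m n} → m ≤ n → ι R n ≈ ι R m + ι R (n ∸ m)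
  ι-∸ {m} {n} m≤n = trans (reflexive (≡.cong (ι R) (≡.sym (ℕ.m+[n∸m]≡n m≤n)))) (ι-+ m (n ∸ m))

-- The ring solver needs a coefficient ring with decidable equality, so it runs over ℤ via the
-- canonical map ℤ → R. That map is computed by fromℕ, which sends 1 to 1# itself, so that the
-- constants 0 and 1 of a solver expression agree definitionally with 0# and 1# in the goal.
module IntegerSolver {c ℓ} (R : CommutativeRing c ℓ) where
  open CommutativeRing R
  open RingProperties ring using (-0#≈0#; -‿involutive; -‿+-comm; -1*x≈-x)
  open CommutativeSemigroupProperties +-commutativeSemigroup using () renaming (interchange to +-interchange)
  open CommutativeSemigroupProperties *-commutativeSemigroup using () renaming (interchange to *-interchange)
  open Numerals R
  open SetoidReasoning setoid

  private
    fromℕ : ℕ → Carrier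
    fromℕ zero          = 0#
    fromℕ (suc zero)    = 1#
    fromℕ (suc (suc n)) = 1# + fromℕ (suc n)

    fromℕ≈ι : ∀ n → fromℕ n ≈ ι R n
    fromℕ≈ι zero          = refl
    fromℕ≈ι (suc zero)    = sym (+-identityʳ 1#)
    fromℕ≈ι (suc (suc n)) = +-cong refl (fromℕ≈ι (suc n))

    fromℤ : ℤ → Carrier
    fromℤ (+ n)    = fromℕ n
    fromℤ -[1+ n ] = - fromℕ (suc n)

    ιℤ : ℤ → Carrier
    ιℤ (+ n)    = ι R n
    ιℤ -[1+ n ] = - ι R (suc n)

    fromℤ≈ιℤ : ∀ z → fromℤ z ≈ ιℤ z
    fromℤ≈ιℤ (+ n)    = fromℕ≈ι n
    fromℤ≈ιℤ -[1+ n ] = -‿cong (fromℕ≈ι (suc n))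

    ιℤ-⊖ : ∀ m n → ιℤ (m ℤ.⊖ n) ≈ ι R m - ι R n
    ιℤ-⊖ zero    zero    = sym (trans (+-identityˡ _) -0#≈0#)
    ιℤ-⊖ (suc m) zero    = sym (trans (+-cong refl -0#≈0#) (+-identityʳ _))
    ιℤ-⊖ zero    (suc n) = sym (+-identityˡ _)
    ιℤ-⊖ (suc m) (suc n) = begin
      ιℤ (suc m ℤ.⊖ suc n)           ≈⟨ reflexive (≡.cong ιℤ (ℤ.[1+m]⊖[1+n]≡m⊖n m n)) ⟩
      ιℤ (m ℤ.⊖ n)                   ≈⟨ ιℤ-⊖ m n ⟩
      ι R m - ι R n                  ≈⟨ sym (+-identityˡ _) ⟩
      0# + (ι R m - ι R n)           ≈⟨ +-cong (sym (-‿inverseʳ 1#)) refl ⟩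
      (1# - 1#) + (ι R m - ι R n)    ≈⟨ +-interchange _ _ _ _ ⟩
      (1# + ι R m) + (- 1# - ι R n)  ≈⟨ +-cong refl (-‿+-comm 1# (ι R n)) ⟩
      (1# + ι R m) - (1# + ι R n)    ∎

    ιℤ-+ : ∀ x y → ιℤ (x ℤ.+ y) ≈ ιℤ x + ιℤ y
    ιℤ-+ (+ m)    (+ n)    = ι-+ m n
    ιℤ-+ (+ m)    -[1+ n ] = ιℤ-⊖ m (suc n)
    ιℤ-+ -[1+ m ] (+ n)    = trans (ιℤ-⊖ n (suc m)) (+-comm _ _)
    ιℤ-+ -[1+ m ] -[1+ n ] = begin
      - ι R (suc (suc (m +ℕ n)))     ≈⟨ -‿cong (reflexive (≡.cong (λ k → ι R (suc k)) (≡.sym (ℕ.+-suc m n)))) ⟩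
      - ι R (suc m +ℕ suc n)         ≈⟨ -‿cong (ι-+ (suc m) (suc n)) ⟩
      - (ι R (suc m) + ι R (suc n))  ≈⟨ sym (-‿+-comm _ _) ⟩
      - ι R (suc m) - ι R (suc n)    ∎

    ιℤ-neg : ∀ x → ιℤ (ℤ.- x) ≈ - ιℤ x
    ιℤ-neg -[1+ n ]  = sym (-‿involutive _)
    ιℤ-neg (+ zero)  = sym -0#≈0#
    ιℤ-neg (+ suc n) = refl

    ιˢ : Sign → Carrier
    ιˢ Sign.+ = 1#
    ιˢ Sign.- = - 1#

    ιˢ-* : ∀ s t → ιˢ (s Sign.* t) ≈ ιˢ s * ιˢ t
    ιˢ-* Sign.+ Sign.+ = sym (*-identityˡ _)
    ιˢ-* Sign.+ Sign.- = sym (*-identityˡ _)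
    ιˢ-* Sign.- Sign.+ = sym (*-identityʳ _)
    ιˢ-* Sign.- Sign.- = sym (trans (-1*x≈-x _) (-‿involutive _))

    ιℤ-◃ : ∀ s n → ιℤ (s ◃ n) ≈ ιˢ s * ι R n
    ιℤ-◃ s      zero    = sym (zeroʳ _)
    ιℤ-◃ Sign.- (suc n) = sym (-1*x≈-x _)
    ιℤ-◃ Sign.+ (suc n) = sym (*-identityˡ _)

    ιℤ-signAbs : ∀ x → ιℤ x ≈ ιˢ (ℤ.sign x) * ι R ∣ x ∣
    ιℤ-signAbs x = trans (reflexive (≡.cong ιℤ (≡.sym (ℤ.◃-inverse x)))) (ιℤ-◃ (ℤ.sign x) ∣ x ∣)

    ιℤ-* : ∀ x y → ιℤ (x ℤ.* y) ≈ ιℤ x * ιℤ y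
    ιℤ-* x y = begin
      ιℤ ((s Sign.* t) ◃ (∣ x ∣ *ℕ ∣ y ∣))     ≈⟨ ιℤ-◃ (s Sign.* t) (∣ x ∣ *ℕ ∣ y ∣) ⟩
      ιˢ (s Sign.* t) * ι R (∣ x ∣ *ℕ ∣ y ∣)   ≈⟨ *-cong (ιˢ-* s t) (ι-* ∣ x ∣ ∣ y ∣) ⟩
      (ιˢ s * ιˢ t) * (ι R ∣ x ∣ * ι R ∣ y ∣)  ≈⟨ *-interchange _ _ _ _ ⟩
      (ιˢ s * ι R ∣ x ∣) * (ιˢ t * ι R ∣ y ∣)  ≈⟨ *-cong (sym (ιℤ-signAbs x)) (sym (ιℤ-signAbs y)) ⟩
      ιℤ x * ιℤ y                              ∎
      where
      s = ℤ.sign x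
      t = ℤ.sign y

    homomorphism : ℤ.+-*-rawRing -Raw-AlmostCommutative⟶ fromCommutativeRing R
    homomorphism = record
      { ⟦_⟧    = fromℤ
      ; +-homo = λ x y → via (x ℤ.+ y) (ιℤ-+ x y) (+-cong (fromℤ≈ιℤ x) (fromℤ≈ιℤ y))
      ; *-homo = λ x y → via (x ℤ.* y) (ιℤ-* x y) (*-cong (fromℤ≈ιℤ x) (fromℤ≈ιℤ y))
      ; -‿homo = λ x → via (ℤ.- x) (ιℤ-neg x) (-‿cong (fromℤ≈ιℤ x))
      ; 0-homo = refl
      ; 1-homo = refl
      }
      where
      via : ∀ z {a b} → ιℤ z ≈ a → b ≈ a → fromℤ z ≈ b
      via z p q = trans (fromℤ≈ιℤ z) (trans p (sym q))

    fromℤ-≡ : ∀ x y → Maybe.Maybe (fromℤ x ≈ fromℤ y)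
    fromℤ-≡ x y = Maybe.map (λ x≡y → reflexive (≡.cong fromℤ x≡y)) (dec⇒maybe (x ℤ.≟ y))

  open RingSolver ℤ.+-*-rawRing (fromCommutativeRing R) homomorphism fromℤ-≡ public

module FiniteSums {c ℓ} (R : CommutativeRing c ℓ) where
  open CommutativeRing R
  open Numerals R
  open RingProperties ring using (-‿+-comm)
  open CommutativeSemigroupProperties +-commutativeSemigroup using () renaming (interchange to +-interchange)
  open SetoidReasoning setoid

  ∑ : ℕ → (ℕ → Carrier) → Carrier
  ∑ zero    f = 0#
  ∑ (suc n) f = ∑ n f + f n

  ∑-cong : ∀ n {f g : ℕ → Carrier} → (∀ k → k < n → f k ≈ g k) → ∑ n f ≈ ∑ n g
  ∑-cong zero    f≈g = refl
  ∑-cong (suc n) f≈g = +-cong (∑-cong n (λ k k<n → f≈g k (ℕ.m<n⇒m<1+n k<n))) (f≈g n (ℕ.n<1+n n))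

  ∑-zero : ∀ n {f : ℕ → Carrier} → (∀ k → k < n → f k ≈ 0#) → ∑ n f ≈ 0#
  ∑-zero zero    f≈0 = refl
  ∑-zero (suc n) f≈0 =
    trans (+-cong (∑-zero n (λ k k<n → f≈0 k (ℕ.m<n⇒m<1+n k<n))) (f≈0 n (ℕ.n<1+n n))) (+-identityʳ 0#)

  ∑-+ : ∀ n (f g : ℕ → Carrier) → ∑ n (λ k → f k + g k) ≈ ∑ n f + ∑ n g
  ∑-+ zero    f g = sym (+-identityˡ 0#)
  ∑-+ (suc n) f g = begin
    ∑ n (λ k → f k + g k) + (f n + g n)  ≈⟨ +-cong (∑-+ n f g) refl ⟩
    (∑ n f + ∑ n g) + (f n + g n)        ≈⟨ +-interchange _ _ _ _ ⟩
    (∑ n f + f n) + (∑ n g + g n)        ∎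

  ∑-- : ∀ n (f g : ℕ → Carrier) → ∑ n (λ k → f k - g k) ≈ ∑ n f - ∑ n g
  ∑-- zero    f g = sym (-‿inverseʳ 0#)
  ∑-- (suc n) f g = begin
    ∑ n (λ k → f k - g k) + (f n - g n)  ≈⟨ +-cong (∑-- n f g) refl ⟩
    (∑ n f - ∑ n g) + (f n - g n)        ≈⟨ +-interchange _ _ _ _ ⟩
    (∑ n f + f n) + (- ∑ n g - g n)      ≈⟨ +-cong refl (-‿+-comm _ _) ⟩
    (∑ n f + f n) - (∑ n g + g n)        ∎

  ∑-*ˡ : ∀ n a (f : ℕ → Carrier) → ∑ n (λ k → a * f k) ≈ a * ∑ n f
  ∑-*ˡ zero    a f = sym (zeroʳ a)
  ∑-*ˡ (suc n) a f = trans (+-cong (∑-*ˡ n a f) refl) (sym (distribˡ a _ _))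

  ∑-suc-front : ∀ n (f : ℕ → Carrier) → ∑ (suc n) f ≈ f 0 + ∑ n (λ k → f (suc k))
  ∑-suc-front zero    f = +-comm 0# (f 0)
  ∑-suc-front (suc n) f = trans (+-cong (∑-suc-front n f) refl) (+-assoc _ _ _)

  ∑-reverse : ∀ n (f : ℕ → Carrier) → ∑ n f ≈ ∑ n (λ k → f (n ∸ suc k))
  ∑-reverse zero    f = refl
  ∑-reverse (suc n) f = begin
    ∑ n f + f n                        ≈⟨ +-cong (∑-reverse n f) refl ⟩
    ∑ n (λ k → f (n ∸ suc k)) + f n    ≈⟨ +-comm _ _ ⟩
    f n + ∑ n (λ k → f (n ∸ suc k))    ≈⟨ sym (∑-suc-front n (λ k → f (n ∸ k))) ⟩
    ∑ (suc n) (λ k → f (n ∸ k))        ∎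

  ∑-suc-*ˡ : ∀ n {f g : ℕ → Carrier} a x → (∀ k → k < n → g k ≈ a * f k) → g n ≈ a * x →
             ∑ (suc n) g ≈ a * (∑ n f + x)
  ∑-suc-*ˡ n {f} a x g≈af gn≈ax = begin
    ∑ n _ + _                      ≈⟨ +-cong (∑-cong n g≈af) gn≈ax ⟩
    ∑ n (λ k → a * f k) + a * x    ≈⟨ +-cong (∑-*ˡ n a f) refl ⟩
    a * ∑ n f + a * x              ≈⟨ sym (distribˡ a _ _) ⟩
    a * (∑ n f + x)                ∎

  ∑ₐ : ℕ → (ℕ → ℕ → Carrier) → Carrier
  ∑ₐ N t = ∑ (suc N) (λ k → t k (N ∸ k))

  ∑ₐ-cong : ∀ N {s t : ℕ → ℕ → Carrier} → (∀ k m → s k m ≈ t k m) → ∑ₐ N s ≈ ∑ₐ N t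
  ∑ₐ-cong N s≈t = ∑-cong (suc N) (λ k _ → s≈t k (N ∸ k))

  ∑ₐ-flip : ∀ N (t : ℕ → ℕ → Carrier) → ∑ₐ N t ≈ ∑ₐ N (λ k m → t m k)
  ∑ₐ-flip N t = trans (∑-reverse (suc N) _) (∑-cong (suc N) flip)
    where
    flip : ∀ k → k < suc N → t (N ∸ k) (N ∸ (N ∸ k)) ≈ t (N ∸ k) k
    flip k k<1+N = reflexive (≡.cong (t (N ∸ k)) (ℕ.m∸[m∸n]≡n (ℕ.≤-pred k<1+N)))

  ∑ₐ-ι-split : ∀ N (t : ℕ → ℕ → Carrier) →
    ι R N * ∑ₐ N t ≈ ∑ₐ N (λ k m → ι R k * t k m) + ∑ₐ N (λ k m → ι R m * t k m)
  ∑ₐ-ι-split N t = trans (sym (∑-*ˡ (suc N) _ _)) (trans (∑-cong (suc N) split) (∑-+ (suc N) _ _))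
    where
    split : ∀ k → k < suc N → ι R N * t k (N ∸ k) ≈ ι R k * t k (N ∸ k) + ι R (N ∸ k) * t k (N ∸ k)
    split k k<1+N = trans (*-cong (ι-∸ (ℕ.≤-pred k<1+N)) refl) (distribʳ _ _ _)

  ∑ₐ-ι-fst : ∀ N (t : ℕ → ℕ → Carrier) →
    ∑ₐ (suc N) (λ k m → ι R k * t k m) ≈ ∑ₐ N (λ k m → ι R (suc k) * t (suc k) m)
  ∑ₐ-ι-fst N t = begin
    ∑ₐ (suc N) (λ k m → ι R k * t k m)                             ≈⟨ ∑-suc-front (suc N) _ ⟩
    0# * t 0 (suc N) + ∑ₐ N (λ k m → ι R (suc k) * t (suc k) m)    ≈⟨ +-cong (zeroˡ _) refl ⟩
    0# + ∑ₐ N (λ k m → ι R (suc k) * t (suc k) m)                  ≈⟨ +-identityˡ _ ⟩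
    ∑ₐ N (λ k m → ι R (suc k) * t (suc k) m)                       ∎

  ∑ₐ-ι-snd : ∀ N (t : ℕ → ℕ → Carrier) →
    ∑ₐ (suc N) (λ k m → ι R m * t k m) ≈ ∑ₐ N (λ k m → ι R (suc m) * t k (suc m))
  ∑ₐ-ι-snd N t = trans (+-cong (∑-cong (suc N) shift) last≈0) (+-identityʳ _)
    where
    shift : ∀ k → k < suc N → ι R (suc N ∸ k) * t k (suc N ∸ k) ≈ ι R (suc (N ∸ k)) * t k (suc (N ∸ k))
    shift k k<1+N = reflexive (≡.cong (λ m → ι R m * t k m) (ℕ.+-∸-assoc 1 (ℕ.≤-pred k<1+N)))
    last≈0 : ι R (suc N ∸ suc N) * t (suc N) (suc N ∸ suc N) ≈ 0#
    last≈0 = trans (reflexive (≡.cong (λ m → ι R m * t (suc N) m) (ℕ.n∸n≡0 N))) (zeroˡ _)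

module Convolution {c ℓ} (R : CommutativeRing c ℓ) where
  open CommutativeRing R
  open Numerals R
  open FiniteSums R
  open IntegerSolver R using (solve; _:+_; _:-_; _:*_; _:=_; con)
  open CommutativeSemigroupProperties *-commutativeSemigroup using () renaming (x∙yz≈y∙xz to x*yz≈y*xz)
  open SetoidReasoning setoid

  module ThreeTerm (u v : ℕ → Carrier) (a b : Carrier)
    (u-rec : ∀ k → ι R (suc k) * u (suc k) ≈ (a + ι R k) * u k)
    (v-rec : ∀ m → ι R (suc m) * v (suc m) ≈ (b - ι R m) * v m)
    where

    t : ℕ → ℕ → Carrier
    t k m = u k * v m

    conv : ℕ → Carrier
    conv N = ∑ₐ N t

    ∑ₐ-ι-fst-rec : ∀ N → ∑ₐ (suc N) (λ k m → ι R k * t k m) ≈ ∑ₐ N (λ k m → (a + ι R k) * t k m)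
    ∑ₐ-ι-fst-rec N = trans (∑ₐ-ι-fst N t) (∑ₐ-cong N step)
      where
      step : ∀ k m → ι R (suc k) * (u (suc k) * v m) ≈ (a + ι R k) * (u k * v m)
      step k m = begin
        ι R (suc k) * (u (suc k) * v m)  ≈⟨ sym (*-assoc _ _ _) ⟩
        (ι R (suc k) * u (suc k)) * v m  ≈⟨ *-cong (u-rec k) refl ⟩
        ((a + ι R k) * u k) * v m        ≈⟨ *-assoc _ _ _ ⟩
        (a + ι R k) * (u k * v m)        ∎

    ∑ₐ-ι-snd-rec : ∀ N → ∑ₐ (suc N) (λ k m → ι R m * t k m) ≈ ∑ₐ N (λ k m → (b - ι R m) * t k m)
    ∑ₐ-ι-snd-rec N = trans (∑ₐ-ι-snd N t) (∑ₐ-cong N step)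
      where
      step : ∀ k m → ι R (suc m) * (u k * v (suc m)) ≈ (b - ι R m) * (u k * v m)
      step k m = begin
        ι R (suc m) * (u k * v (suc m))  ≈⟨ x*yz≈y*xz _ _ _ ⟩
        u k * (ι R (suc m) * v (suc m))  ≈⟨ *-cong refl (v-rec m) ⟩
        u k * ((b - ι R m) * v m)        ≈⟨ x*yz≈y*xz _ _ _ ⟩
        (b - ι R m) * (u k * v m)        ∎

    conv-suc : ∀ N → ι R (suc N) * conv (suc N) ≈ ∑ₐ N (λ k m → ((a + ι R k) + (b - ι R m)) * t k m)
    conv-suc N = begin
      ι R (suc N) * conv (suc N)
        ≈⟨ ∑ₐ-ι-split (suc N) t ⟩
      ∑ₐ (suc N) (λ k m → ι R k * t k m) + ∑ₐ (suc N) (λ k m → ι R m * t k m)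
        ≈⟨ +-cong (∑ₐ-ι-fst-rec N) (∑ₐ-ι-snd-rec N) ⟩
      ∑ₐ N (λ k m → (a + ι R k) * t k m) + ∑ₐ N (λ k m → (b - ι R m) * t k m)
        ≈⟨ sym (∑-+ (suc N) _ _) ⟩
      ∑ₐ N (λ k m → (a + ι R k) * t k m + (b - ι R m) * t k m)
        ≈⟨ ∑ₐ-cong N (λ k m → sym (distribʳ (t k m) (a + ι R k) (b - ι R m))) ⟩
      ∑ₐ N (λ k m → ((a + ι R k) + (b - ι R m)) * t k m)
        ∎

    conv-one : ι R 1 * conv 1 ≈ (a + b) * conv 0
    conv-one = trans (conv-suc 0)
      (solve 3 (λ a b x → con (+ 0) :+ ((a :+ con (+ 0)) :+ (b :- con (+ 0))) :* x
                          := (a :+ b) :* (con (+ 0) :+ x)) refl a b (t 0 0))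

    -- The parts weighted by ι k and by ι m are shifted down one level again; their difference
    -- carries the weight (a + ι k) − (b − ι m), which is constant on the antidiagonal k + m = N.
    conv-three-term : ∀ N →
      ι R (suc (suc N)) * conv (suc (suc N)) ≈ (a + b) * conv (suc N) + ((a - b) + ι R N) * conv N
    conv-three-term N = begin
      ι R (suc (suc N)) * conv (suc (suc N))
        ≈⟨ conv-suc (suc N) ⟩
      ∑ₐ (suc N) (λ k m → ((a + ι R k) + (b - ι R m)) * t k m)
        ≈⟨ ∑ₐ-cong (suc N) regroup ⟩
      ∑ₐ (suc N) (λ k m → (a + b) * t k m + (ι R k * t k m - ι R m * t k m))
        ≈⟨ trans (∑-+ (suc (suc N)) _ _) (+-cong (∑-*ˡ (suc (suc N)) _ _) (∑-- (suc (suc N)) _ _)) ⟩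
      (a + b) * conv (suc N) + (∑ₐ (suc N) (λ k m → ι R k * t k m) - ∑ₐ (suc N) (λ k m → ι R m * t k m))
        ≈⟨ +-cong refl (+-cong (∑ₐ-ι-fst-rec N) (-‿cong (∑ₐ-ι-snd-rec N))) ⟩
      (a + b) * conv (suc N) + (∑ₐ N (λ k m → (a + ι R k) * t k m) - ∑ₐ N (λ k m → (b - ι R m) * t k m))
        ≈⟨ +-cong refl (sym (∑-- (suc N) _ _)) ⟩
      (a + b) * conv (suc N) + ∑ (suc N) (λ k → (a + ι R k) * t k (N ∸ k) - (b - ι R (N ∸ k)) * t k (N ∸ k))
        ≈⟨ +-cong refl (trans (∑-cong (suc N) antidiagonal) (∑-*ˡ (suc N) _ _)) ⟩
      (a + b) * conv (suc N) + ((a - b) + ι R N) * conv N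
        ∎
      where
      regroup : ∀ k m → ((a + ι R k) + (b - ι R m)) * t k m ≈ (a + b) * t k m + (ι R k * t k m - ι R m * t k m)
      regroup k m = solve 5 (λ a b x y z → ((a :+ x) :+ (b :- y)) :* z := (a :+ b) :* z :+ (x :* z :- y :* z))
                      refl a b (ι R k) (ι R m) (t k m)
      antidiagonal : ∀ k → k < suc N →
        (a + ι R k) * t k (N ∸ k) - (b - ι R (N ∸ k)) * t k (N ∸ k) ≈ ((a - b) + ι R N) * t k (N ∸ k)
      antidiagonal k k<1+N = begin
        (a + ι R k) * z - (b - ι R (N ∸ k)) * z
          ≈⟨ solve 5 (λ a b x y z → (a :+ x) :* z :- (b :- y) :* z := ((a :- b) :+ (x :+ y)) :* z)
                     refl a b (ι R k) (ι R (N ∸ k)) z ⟩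
        ((a - b) + (ι R k + ι R (N ∸ k))) * z
          ≈⟨ *-cong (+-cong refl (sym (ι-∸ (ℕ.≤-pred k<1+N)))) refl ⟩
        ((a - b) + ι R N) * z
          ∎
        where z = t k (N ∸ k)

record Derivation {c ℓ} (R : CommutativeRing c ℓ) : Set (c ⊔ ℓ) where
  open CommutativeRing R
  field
    δ      : Carrier → Carrier
    δ-cong : ∀ {x y} → x ≈ y → δ x ≈ δ y
    δ-+    : ∀ x y → δ (x + y) ≈ δ x + δ y
    δ-*    : ∀ x y → δ (x * y) ≈ δ x * y + x * δ y

module Wronskian {c ℓ} (R : CommutativeRing c ℓ) (∂ : Derivation R) where
  open CommutativeRing R
  open Derivation ∂
  open IntegerSolver R using (solve; _:+_; _:-_; _:*_; _:=_; con)
  open SetoidReasoning setoid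

  W : Carrier → Carrier → Carrier
  W p q = p * δ q - q * δ p

  W-cong : ∀ {p p′ q q′} → p ≈ p′ → q ≈ q′ → W p q ≈ W p′ q′
  W-cong p≈p′ q≈q′ = +-cong (*-cong p≈p′ (δ-cong q≈q′)) (-‿cong (*-cong q≈q′ (δ-cong p≈p′)))

  δ-constant-* : ∀ {A} x → δ A ≈ 0# → δ (A * x) ≈ A * δ x
  δ-constant-* {A} x δA≈0 = begin
    δ (A * x)          ≈⟨ δ-* A x ⟩
    δ A * x + A * δ x  ≈⟨ +-cong (trans (*-cong δA≈0 refl) (zeroˡ x)) refl ⟩
    0# + A * δ x       ≈⟨ +-identityˡ _ ⟩
    A * δ x            ∎

  W-one : δ 1# ≈ 0# → ∀ p → W 1# p ≈ δ p
  W-one δ1≈0 p = trans (+-cong (*-identityˡ _) (-‿cong (trans (*-cong refl δ1≈0) (zeroʳ p))))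
                       (solve 1 (λ x → x :- con (+ 0) := x) refl (δ p))

  -- Expanding A δp₂ = δ (A p₂) by the recurrence, the terms L p₁ δp₁ cancel.
  W-three-term : ∀ {A B L p₀ p₁ p₂} → δ A ≈ 0# → δ B ≈ 0# → A * p₂ ≈ L * p₁ + B * p₀ →
                 A * W p₁ p₂ ≈ δ L * (p₁ * p₁) - B * W p₀ p₁
  W-three-term {A} {B} {L} {p₀} {p₁} {p₂} δA≈0 δB≈0 rec = begin
    A * W p₁ p₂
      ≈⟨ solve 5 (λ A p₁ p₂ x y → A :* (p₁ :* x :- p₂ :* y) := p₁ :* (A :* x) :- (A :* p₂) :* y)
                 refl A p₁ p₂ (δ p₂) (δ p₁) ⟩
    p₁ * (A * δ p₂) - (A * p₂) * δ p₁
      ≈⟨ +-cong (*-cong refl Aδp₂) (-‿cong (*-cong rec refl)) ⟩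
    p₁ * ((δ L * p₁ + L * δ p₁) + B * δ p₀) - (L * p₁ + B * p₀) * δ p₁
      ≈⟨ solve 7 (λ p₀ p₁ x y l L B → p₁ :* ((l :* p₁ :+ L :* y) :+ B :* x) :- (L :* p₁ :+ B :* p₀) :* y
                                      := l :* (p₁ :* p₁) :- B :* (p₀ :* y :- p₁ :* x))
                 refl p₀ p₁ (δ p₀) (δ p₁) (δ L) L B ⟩
    δ L * (p₁ * p₁) - B * W p₀ p₁
      ∎
    where
    Aδp₂ : A * δ p₂ ≈ (δ L * p₁ + L * δ p₁) + B * δ p₀
    Aδp₂ = begin
      A * δ p₂                          ≈⟨ sym (δ-constant-* p₂ δA≈0) ⟩
      δ (A * p₂)                        ≈⟨ δ-cong rec ⟩
      δ (L * p₁ + B * p₀)               ≈⟨ δ-+ _ _ ⟩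
      δ (L * p₁) + δ (B * p₀)           ≈⟨ +-cong (δ-* L p₁) (δ-constant-* p₀ δB≈0) ⟩
      (δ L * p₁ + L * δ p₁) + B * δ p₀  ∎

module PowerSeries {c ℓ} (F : CharZeroField c ℓ) where
  open CharZeroField F
  open Poly F
  open FiniteSums cring
  open SetoidReasoning setoid

  sumK≈∑ : ∀ n f → sumK n f ≈ ∑ n f
  sumK≈∑ zero    f = refl
  sumK≈∑ (suc n) f = +-cong (sumK≈∑ n f) refl

  ⊗≈∑ₐ : ∀ p q i → (p ⊗ q) i ≈ ∑ₐ i (λ j m → p j * q m)
  ⊗≈∑ₐ p q i = sumK≈∑ (suc i) _

  ≋-refl : ∀ {p} → p ≋ p
  ≋-refl i = refl

  ≋-sym : ∀ {p q} → p ≋ q → q ≋ p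
  ≋-sym p≋q i = sym (p≋q i)

  ≋-trans : ∀ {p q s} → p ≋ q → q ≋ s → p ≋ s
  ≋-trans p≋q q≋s i = trans (p≋q i) (q≋s i)

  const0≋0 : ∀ i → const 0# i ≈ 0#
  const0≋0 zero    = refl
  const0≋0 (suc i) = refl

  ⊗-cong : ∀ {p p′ q q′} → p ≋ p′ → q ≋ q′ → (p ⊗ q) ≋ (p′ ⊗ q′)
  ⊗-cong {p} {p′} {q} {q′} p≋p′ q≋q′ i = begin
    (p ⊗ q) i                    ≈⟨ ⊗≈∑ₐ p q i ⟩
    ∑ₐ i (λ j m → p j * q m)     ≈⟨ ∑ₐ-cong i (λ j m → *-cong (p≋p′ j) (q≋q′ m)) ⟩
    ∑ₐ i (λ j m → p′ j * q′ m)   ≈⟨ sym (⊗≈∑ₐ p′ q′ i) ⟩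
    (p′ ⊗ q′) i                  ∎

  ⊗-comm : ∀ p q → (p ⊗ q) ≋ (q ⊗ p)
  ⊗-comm p q i = begin
    (p ⊗ q) i                    ≈⟨ ⊗≈∑ₐ p q i ⟩
    ∑ₐ i (λ j m → p j * q m)     ≈⟨ ∑ₐ-flip i (λ j m → p j * q m) ⟩
    ∑ₐ i (λ j m → p m * q j)     ≈⟨ ∑ₐ-cong i (λ j m → *-comm (p m) (q j)) ⟩
    ∑ₐ i (λ j m → q j * p m)     ≈⟨ sym (⊗≈∑ₐ q p i) ⟩
    (q ⊗ p) i                    ∎

  const-⊗ : ∀ a p → (const a ⊗ p) ≋ (a · p)
  const-⊗ a p i = begin
    (const a ⊗ p) i                                 ≈⟨ ⊗≈∑ₐ (const a) p i ⟩
    ∑ₐ i (λ j m → const a j * p m)                  ≈⟨ ∑-suc-front i _ ⟩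
    a * p i + ∑ i (λ j → 0# * p (i ∸ suc j))        ≈⟨ +-cong refl (∑-zero i (λ j _ → zeroˡ _)) ⟩
    a * p i + 0#                                    ≈⟨ +-identityʳ _ ⟩
    a * p i                                         ∎

  ·-⊗ : ∀ a p q → ((a · p) ⊗ q) ≋ (a · (p ⊗ q))
  ·-⊗ a p q i = begin
    ((a · p) ⊗ q) i                     ≈⟨ ⊗≈∑ₐ (a · p) q i ⟩
    ∑ₐ i (λ j m → (a * p j) * q m)      ≈⟨ ∑ₐ-cong i (λ j m → *-assoc a (p j) (q m)) ⟩
    ∑ₐ i (λ j m → a * (p j * q m))      ≈⟨ ∑-*ˡ (suc i) a _ ⟩
    a * ∑ₐ i (λ j m → p j * q m)        ≈⟨ *-cong refl (sym (⊗≈∑ₐ p q i)) ⟩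
    a * (p ⊗ q) i                       ∎

  ⊗-distribʳ : ∀ p q s → ((p ⊕ q) ⊗ s) ≋ ((p ⊗ s) ⊕ (q ⊗ s))
  ⊗-distribʳ p q s i = begin
    ((p ⊕ q) ⊗ s) i                                      ≈⟨ ⊗≈∑ₐ (p ⊕ q) s i ⟩
    ∑ₐ i (λ j m → (p j + q j) * s m)                     ≈⟨ ∑ₐ-cong i (λ j m → distribʳ (s m) (p j) (q j)) ⟩
    ∑ₐ i (λ j m → p j * s m + q j * s m)                 ≈⟨ ∑-+ (suc i) _ _ ⟩
    ∑ₐ i (λ j m → p j * s m) + ∑ₐ i (λ j m → q j * s m)  ≈⟨ +-cong (sym (⊗≈∑ₐ p s i)) (sym (⊗≈∑ₐ q s i)) ⟩
    (p ⊗ s) i + (q ⊗ s) i                                ∎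

  shift : Pol → Pol
  shift p zero    = 0#
  shift p (suc i) = p i

  tail : Pol → Pol
  tail p i = p (suc i)

  shift-⊗ : ∀ p q → (shift p ⊗ q) ≋ shift (p ⊗ q)
  shift-⊗ p q zero    = trans (+-identityˡ _) (zeroˡ _)
  shift-⊗ p q (suc i) = begin
    (shift p ⊗ q) (suc i)                              ≈⟨ sumK≈∑ (suc (suc i)) _ ⟩
    ∑ₐ (suc i) (λ j m → shift p j * q m)               ≈⟨ ∑-suc-front (suc i) _ ⟩
    0# * q (suc i) + ∑ₐ i (λ j m → p j * q m)          ≈⟨ +-cong (zeroˡ _) (sym (⊗≈∑ₐ p q i)) ⟩
    0# + (p ⊗ q) i                                     ≈⟨ +-identityˡ _ ⟩
    (p ⊗ q) i                                          ∎

  ⊗-head-tail : ∀ p q → (p ⊗ q) ≋ ((p 0 · q) ⊕ shift (tail p ⊗ q))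
  ⊗-head-tail p q i = begin
    (p ⊗ q) i                                          ≈⟨ ⊗-cong {q = q} head-tail ≋-refl i ⟩
    ((const (p 0) ⊕ shift (tail p)) ⊗ q) i             ≈⟨ ⊗-distribʳ (const (p 0)) (shift (tail p)) q i ⟩
    (const (p 0) ⊗ q) i + (shift (tail p) ⊗ q) i       ≈⟨ +-cong (const-⊗ (p 0) q i) (shift-⊗ (tail p) q i) ⟩
    p 0 * q i + shift (tail p ⊗ q) i                   ∎
    where
    head-tail : p ≋ (const (p 0) ⊕ shift (tail p))
    head-tail zero    = sym (+-identityʳ _)
    head-tail (suc i) = sym (+-identityˡ _)

  -- Induction on the coefficient index, peeling off the constant term of p.
  ⊗-assoc : ∀ p q s i → ((p ⊗ q) ⊗ s) i ≈ (p ⊗ (q ⊗ s)) i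
  ⊗-assoc p q s i = begin
    ((p ⊗ q) ⊗ s) i                                    ≈⟨ ⊗-cong {q = s} (⊗-head-tail p q) ≋-refl i ⟩
    (((p 0 · q) ⊕ shift (tail p ⊗ q)) ⊗ s) i           ≈⟨ ⊗-distribʳ (p 0 · q) (shift (tail p ⊗ q)) s i ⟩
    ((p 0 · q) ⊗ s) i + (shift (tail p ⊗ q) ⊗ s) i     ≈⟨ +-cong (·-⊗ (p 0) q s i) (shift-⊗ (tail p ⊗ q) s i) ⟩
    p 0 * (q ⊗ s) i + shift ((tail p ⊗ q) ⊗ s) i       ≈⟨ +-cong refl (shifted i) ⟩
    p 0 * (q ⊗ s) i + shift (tail p ⊗ (q ⊗ s)) i       ≈⟨ sym (⊗-head-tail p (q ⊗ s) i) ⟩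
    (p ⊗ (q ⊗ s)) i                                    ∎
    where
    shifted : ∀ i → shift ((tail p ⊗ q) ⊗ s) i ≈ shift (tail p ⊗ (q ⊗ s)) i
    shifted zero    = refl
    shifted (suc j) = ⊗-assoc (tail p) q s j

  neg : Pol → Pol
  neg p i = - p i

  -- Coefficientwise equality, wrapped in a record so that both sides can be inferred from it.
  record _≈ₚ_ (p q : Pol) : Set ℓ where
    constructor coeffs
    field coeff : p ≋ q
  open _≈ₚ_ public

  infix 4 _≈ₚ_

  ⊕-⊗-commutativeRing : CommutativeRing c ℓ
  ⊕-⊗-commutativeRing = record
    { Carrier = Pol
    ; _≈_ = _≈ₚ_
    ; _+_ = _⊕_
    ; _*_ = _⊗_
    ; -_ = neg
    ; 0# = const 0#
    ; 1# = const 1#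
    ; isCommutativeRing = record
      { isRing = record
        { +-isAbelianGroup = record
          { isGroup = record
            { isMonoid = record
              { isSemigroup = record
                { isMagma = record
                  { isEquivalence = record
                    { refl = coeffs ≋-refl
                    ; sym = λ p≈q → coeffs (≋-sym (coeff p≈q))
                    ; trans = λ p≈q q≈s → coeffs (≋-trans (coeff p≈q) (coeff q≈s))
                    }
                  ; ∙-cong = λ p≈p′ q≈q′ → coeffs (λ i → +-cong (coeff p≈p′ i) (coeff q≈q′ i))
                  }
                ; assoc = λ p q s → coeffs (λ i → +-assoc _ _ _)
                }
              ; identity = (λ p → coeffs (λ i → trans (+-cong (const0≋0 i) refl) (+-identityˡ _)))
                         , (λ p → coeffs (λ i → trans (+-cong refl (const0≋0 i)) (+-identityʳ _)))
              }
            ; inverse = (λ p → coeffs (λ i → trans (-‿inverseˡ _) (sym (const0≋0 i))))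
                      , (λ p → coeffs (λ i → trans (-‿inverseʳ _) (sym (const0≋0 i))))
            ; ⁻¹-cong = λ p≈q → coeffs (λ i → -‿cong (coeff p≈q i))
            }
          ; comm = λ p q → coeffs (λ i → +-comm _ _)
          }
        ; *-cong = λ p≈p′ q≈q′ → coeffs (⊗-cong (coeff p≈p′) (coeff q≈q′))
        ; *-assoc = λ p q s → coeffs (⊗-assoc p q s)
        ; *-identity = (λ p → coeffs (one-⊗ p))
                     , (λ p → coeffs (≋-trans (⊗-comm p (const 1#)) (one-⊗ p)))
        ; distrib = (λ s p q → coeffs (≋-trans (⊗-comm s (p ⊕ q))
                                        (≋-trans (⊗-distribʳ p q s) (λ i → +-cong (⊗-comm p s i) (⊗-comm q s i)))))
                  , (λ s p q → coeffs (⊗-distribʳ p q s))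
        }
      ; *-comm = λ p q → coeffs (⊗-comm p q)
      }
    }
    where
    one-⊗ : ∀ p → (const 1# ⊗ p) ≋ p
    one-⊗ p i = trans (const-⊗ 1# p i) (*-identityˡ _)


module PowerSeriesProperties {c ℓ} (F : CharZeroField c ℓ) where
  open CharZeroField F
  open Poly F
  open PowerSeries F
  open FiniteSums cring
  open RingProperties ring using (-0#≈0#)
  open CommutativeSemigroupProperties *-commutativeSemigroup using () renaming (x∙yz≈y∙xz to x*yz≈y*xz)
  open SetoidReasoning setoid
  module ℙ = CommutativeRing ⊕-⊗-commutativeRing
  module ℙ∑ = FiniteSums ⊕-⊗-commutativeRing

  const-cong : ∀ {a b} → a ≈ b → const a ≈ₚ const b
  const-cong a≈b = coeffs λ { zero → a≈b ; (suc i) → refl }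

  const-+ : ∀ a b → const (a + b) ≈ₚ const a ⊕ const b
  const-+ a b = coeffs λ { zero → refl ; (suc i) → sym (+-identityˡ 0#) }

  const-neg : ∀ a → const (- a) ≈ₚ neg (const a)
  const-neg a = coeffs λ { zero → refl ; (suc i) → sym -0#≈0# }

  ·≈const-⊗ : ∀ a p → a · p ≈ₚ const a ⊗ p
  ·≈const-⊗ a p = coeffs (≋-sym (const-⊗ a p))

  ·-congˡ : ∀ a {p q} → p ≈ₚ q → a · p ≈ₚ a · q
  ·-congˡ a p≈q = coeffs (λ i → *-cong refl (coeff p≈q i))

  *-const : ∀ x y i → x * const y i ≈ const (x * y) i
  *-const x y zero    = refl
  *-const x y (suc i) = zeroʳ x

  ι≈const : ∀ n → ι ⊕-⊗-commutativeRing n ≈ₚ const (n̂ n)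
  ι≈const zero    = ℙ.refl
  ι≈const (suc n) = ℙ.trans (ℙ.+-cong ℙ.refl (ι≈const n)) (ℙ.sym (const-+ 1# (n̂ n)))

  sumP≈∑ : ∀ n f → sumP n f ≈ₚ ℙ∑.∑ n f
  sumP≈∑ zero    f = ℙ.refl
  sumP≈∑ (suc n) f = ℙ.+-cong (sumP≈∑ n f) ℙ.refl

  sumP-coeff : ∀ n f i → sumP n f i ≈ ∑ n (λ k → f k i)
  sumP-coeff zero    f i = const0≋0 i
  sumP-coeff (suc n) f i = +-cong (sumP-coeff n f i) refl

  prodP-cong : ∀ n {f g} → (∀ j → f j ≈ₚ g j) → prodP n f ≈ₚ prodP n g
  prodP-cong zero    f≈g = ℙ.refl
  prodP-cong (suc n) f≈g = ℙ.*-cong (prodP-cong n f≈g) (f≈g n)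

  prodP-suc-front : ∀ n f → prodP (suc n) f ≈ₚ f 0 ⊗ prodP n (λ j → f (suc j))
  prodP-suc-front zero    f = ℙ.*-comm _ _
  prodP-suc-front (suc n) f = ℙ.trans (ℙ.*-cong (prodP-suc-front n f) (ℙ.refl {f (suc n)}))
                                      (ℙ.*-assoc (f 0) (prodP n (λ j → f (suc j))) (f (suc n)))

  deriv-cong : ∀ {p q} → p ≈ₚ q → deriv p ≈ₚ deriv q
  deriv-cong p≈q = coeffs (λ i → *-cong refl (coeff p≈q (suc i)))

  deriv-⊕ : ∀ p q → deriv (p ⊕ q) ≈ₚ deriv p ⊕ deriv q
  deriv-⊕ p q = coeffs (λ i → distribˡ _ _ _)

  deriv-const : ∀ a → deriv (const a) ≈ₚ const 0#
  deriv-const a = coeffs (λ i → trans (zeroʳ _) (sym (const0≋0 i)))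

  deriv-X : deriv X ≈ₚ const 1#
  deriv-X = coeffs λ { zero → trans (*-identityʳ _) (+-identityʳ 1#) ; (suc i) → zeroʳ _ }

  -- Leibniz rule: split the factor i + 1 of the (i + 1)-th coefficient as j + m on the antidiagonal.
  deriv-⊗ : ∀ p q → deriv (p ⊗ q) ≈ₚ (deriv p ⊗ q) ⊕ (p ⊗ deriv q)
  deriv-⊗ p q = coeffs λ i → begin
    n̂ (suc i) * (p ⊗ q) (suc i)
      ≈⟨ *-cong refl (⊗≈∑ₐ p q (suc i)) ⟩
    n̂ (suc i) * ∑ₐ (suc i) t
      ≈⟨ ∑ₐ-ι-split (suc i) t ⟩
    ∑ₐ (suc i) (λ j m → n̂ j * t j m) + ∑ₐ (suc i) (λ j m → n̂ m * t j m)
      ≈⟨ +-cong (∑ₐ-ι-fst i t) (∑ₐ-ι-snd i t) ⟩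
    ∑ₐ i (λ j m → n̂ (suc j) * t (suc j) m) + ∑ₐ i (λ j m → n̂ (suc m) * t j (suc m))
      ≈⟨ +-cong (∑ₐ-cong i (λ j m → sym (*-assoc (n̂ (suc j)) (p (suc j)) (q m))))
                (∑ₐ-cong i (λ j m → x*yz≈y*xz (n̂ (suc m)) (p j) (q (suc m)))) ⟩
    ∑ₐ i (λ j m → deriv p j * q m) + ∑ₐ i (λ j m → p j * deriv q m)
      ≈⟨ +-cong (sym (⊗≈∑ₐ (deriv p) q i)) (sym (⊗≈∑ₐ p (deriv q) i)) ⟩
    (deriv p ⊗ q) i + (p ⊗ deriv q) i
      ∎
    where
    t : ℕ → ℕ → Carrier
    t j m = p j * q m

  derivation : Derivation ⊕-⊗-commutativeRing
  derivation = record { δ = deriv ; δ-cong = deriv-cong ; δ-+ = deriv-⊕ ; δ-* = deriv-⊗ }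

module CharZeroFieldProperties {c ℓ} (F : CharZeroField c ℓ) where
  open CharZeroField F
  open Poly F using (n̂)
  open IntegerSolver cring using (solve; _:*_; _:=_)
  open SetoidReasoning setoid

  ⁻¹-inverseˡ : ∀ {x} → ¬ x ≈ 0# → x ⁻¹ * x ≈ 1#
  ⁻¹-inverseˡ x≉0 = trans (*-comm _ _) (⁻¹-inverse _ x≉0)

  n̂≉0 : ∀ {n} → 1 ≤ n → ¬ n̂ n ≈ 0#
  n̂≉0 {suc n} _ = char0 n

  x*y≈z⇒x*z⁻¹≈y⁻¹ : ∀ {x y z} → x * y ≈ z → ¬ y ≈ 0# → ¬ z ≈ 0# → x * z ⁻¹ ≈ y ⁻¹
  x*y≈z⇒x*z⁻¹≈y⁻¹ {x} {y} {z} xy≈z y≉0 z≉0 = begin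
    x * z ⁻¹                 ≈⟨ sym (*-identityʳ _) ⟩
    (x * z ⁻¹) * 1#          ≈⟨ *-cong refl (sym (⁻¹-inverse y y≉0)) ⟩
    (x * z ⁻¹) * (y * y ⁻¹)  ≈⟨ solve 4 (λ x z′ y y′ → (x :* z′) :* (y :* y′) := ((x :* y) :* z′) :* y′)
                                        refl x (z ⁻¹) y (y ⁻¹) ⟩
    ((x * y) * z ⁻¹) * y ⁻¹  ≈⟨ *-cong (*-cong xy≈z refl) refl ⟩
    (z * z ⁻¹) * y ⁻¹        ≈⟨ *-cong (⁻¹-inverse z z≉0) refl ⟩
    1# * y ⁻¹                ≈⟨ *-identityˡ _ ⟩
    y ⁻¹                     ∎

  n̂-suc-*-factorial⁻¹ : ∀ k → n̂ (suc k) * n̂ (suc k !) ⁻¹ ≈ n̂ (k !) ⁻¹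
  n̂-suc-*-factorial⁻¹ k = x*y≈z⇒x*z⁻¹≈y⁻¹ (sym (Numerals.ι-* cring (suc k) (k !)))
                            (n̂≉0 (ℕ.1≤n! k)) (n̂≉0 (ℕ.1≤n! (suc k)))

  n̂1⁻¹≈1 : n̂ 1 ⁻¹ ≈ 1#
  n̂1⁻¹≈1 = begin
    n̂ 1 ⁻¹        ≈⟨ sym (*-identityˡ _) ⟩
    1# * n̂ 1 ⁻¹   ≈⟨ *-cong (sym (+-identityʳ 1#)) refl ⟩
    n̂ 1 * n̂ 1 ⁻¹  ≈⟨ ⁻¹-inverse _ (char0 0) ⟩
    1#            ∎

module BinomialPolynomials {c ℓ} (F : CharZeroField c ℓ) where
  open CharZeroField F
  open Poly F
  open PowerSeries F
  open PowerSeriesProperties F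
  open CharZeroFieldProperties F
  open SetoidReasoning ℙ.setoid

  binom-zero : ∀ p → binom p 0 ≈ₚ const 1#
  binom-zero p = coeffs (λ i → trans (*-cong n̂1⁻¹≈1 refl) (*-identityˡ _))

  n̂-suc-⊗-factorial⁻¹ : ∀ k p q →
    const (n̂ (suc k)) ⊗ ((n̂ (suc k !) ⁻¹) · (p ⊗ q)) ≈ₚ q ⊗ ((n̂ (k !) ⁻¹) · p)
  n̂-suc-⊗-factorial⁻¹ k p q = begin
    const (n̂ (suc k)) ⊗ ((n̂ (suc k !) ⁻¹) · (p ⊗ q))
      ≈⟨ coeffs (const-⊗ _ _) ⟩
    n̂ (suc k) · ((n̂ (suc k !) ⁻¹) · (p ⊗ q))
      ≈⟨ coeffs (λ i → trans (sym (*-assoc _ _ _)) (*-cong (n̂-suc-*-factorial⁻¹ k) refl)) ⟩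
    (n̂ (k !) ⁻¹) · (p ⊗ q)
      ≈⟨ coeffs (≋-sym (·-⊗ _ p q)) ⟩
    ((n̂ (k !) ⁻¹) · p) ⊗ q
      ≈⟨ ℙ.*-comm _ q ⟩
    q ⊗ ((n̂ (k !) ⁻¹) · p)
      ∎

  binom-suc : ∀ p k → const (n̂ (suc k)) ⊗ binom p (suc k) ≈ₚ (p ⊖ const (n̂ k)) ⊗ binom p k
  binom-suc p k = n̂-suc-⊗-factorial⁻¹ k (prodP k (λ j → p ⊖ const (n̂ j))) (p ⊖ const (n̂ k))

  binom-suc-shift : ∀ {p p′} k → (∀ j → p′ ⊖ const (n̂ (suc j)) ≈ₚ p ⊖ const (n̂ j)) →
    const (n̂ (suc k)) ⊗ binom p′ (suc k) ≈ₚ (p′ ⊖ const 0#) ⊗ binom p k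
  binom-suc-shift {p} {p′} k shifted = begin
    const (n̂ (suc k)) ⊗ binom p′ (suc k)
      ≈⟨ ℙ.*-cong ℙ.refl (·-congˡ _ peel) ⟩
    const (n̂ (suc k)) ⊗ ((n̂ (suc k !) ⁻¹) · (prodP k f ⊗ f′ 0))
      ≈⟨ n̂-suc-⊗-factorial⁻¹ k (prodP k f) (f′ 0) ⟩
    f′ 0 ⊗ binom p k
      ∎
    where
    f f′ : ℕ → Pol
    f  j = p ⊖ const (n̂ j)
    f′ j = p′ ⊖ const (n̂ j)
    peel : prodP (suc k) f′ ≈ₚ prodP k f ⊗ f′ 0
    peel = ℙ.trans (prodP-suc-front k f′) (ℙ.trans (ℙ.*-cong ℙ.refl (prodP-cong k shifted)) (ℙ.*-comm _ _))

module WeightedSums {c ℓ} (F : CharZeroField c ℓ) where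
  open CharZeroField F
  open Poly F
  open PowerSeriesProperties F using (sumP-coeff)
  open FiniteSums cring
  open SetoidReasoning setoid

  prodK-suc-∸ : ∀ (φ : ℕ → Carrier) {n k} → k ≤ n →
    prodK (suc n ∸ k) (λ j → φ (suc (k +ℕ j))) ≈ φ (suc n) * prodK (n ∸ k) (λ j → φ (suc (k +ℕ j)))
  prodK-suc-∸ φ {n} {k} k≤n = begin
    prodK (suc n ∸ k) g
      ≈⟨ reflexive (≡.cong (λ l → prodK l g) (ℕ.+-∸-assoc 1 k≤n)) ⟩
    prodK (n ∸ k) g * φ (suc (k +ℕ (n ∸ k)))
      ≈⟨ *-cong refl (reflexive (≡.cong (λ l → φ (suc l)) (ℕ.m+[n∸m]≡n k≤n))) ⟩
    prodK (n ∸ k) g * φ (suc n)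
      ≈⟨ *-comm _ _ ⟩
    φ (suc n) * prodK (n ∸ k) g
      ∎
    where
    g : ℕ → Carrier
    g j = φ (suc (k +ℕ j))

  prodK-suc-∸-self : ∀ (φ : ℕ → Carrier) n →
    prodK (suc n ∸ n) (λ j → φ (suc (n +ℕ j))) ≈ φ (suc n) * 1#
  prodK-suc-∸-self φ n = trans (prodK-suc-∸ φ ℕ.≤-refl)
    (*-cong refl (reflexive (≡.cong (λ l → prodK l (λ j → φ (suc (n +ℕ j)))) (ℕ.n∸n≡0 n))))

  sumP-suc-scaled : ∀ n (a : ℕ → ℕ → Carrier) (Q : ℕ → Pol) c x →
    (∀ k → k < n → a (suc n) k ≈ c * a n k) → a (suc n) n ≈ c * x →
    ∀ i → sumP (suc n) (λ k → a (suc n) k · Q k) i ≈ c * (sumP n (λ k → a n k · Q k) i + x * Q n i)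
  sumP-suc-scaled n a Q c x earlier last i = begin
    sumP (suc n) (λ k → a (suc n) k · Q k) i
      ≈⟨ sumP-coeff (suc n) _ i ⟩
    ∑ (suc n) (λ k → a (suc n) k * Q k i)
      ≈⟨ ∑-suc-*ˡ n c (x * Q n i) (λ k k<n → scaled (earlier k k<n)) (scaled last) ⟩
    c * (∑ n (λ k → a n k * Q k i) + x * Q n i)
      ≈⟨ *-cong refl (+-cong (sym (sumP-coeff n _ i)) refl) ⟩
    c * (sumP n (λ k → a n k · Q k) i + x * Q n i)
      ∎
    where
    scaled : ∀ {y z q} → y ≈ c * z → y * q ≈ c * (z * q)
    scaled y≈cz = trans (*-cong y≈cz refl) (*-assoc _ _ _)

module DPolynomials {c ℓ} (F : CharZeroField c ℓ) (r : CharZeroField.Carrier F) where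
  open CharZeroField F
  open Poly F
  open PowerSeries F
  open PowerSeriesProperties F
  open WeightedSums F
  open Wronskian ⊕-⊗-commutativeRing derivation
  open RingProperties ring using (-‿distribˡ-*)

  γ : ℕ → Carrier
  γ n = n̂ n * (n̂ n + (r + r))

  D-three-term : ∀ m → const 1# ⊗ D r (suc (suc m)) ≈ₚ (X ⊗ D r (suc m)) ⊕ (const (- γ (suc m)) ⊗ D r m)
  D-three-term m = ℙ.trans (ℙ.*-identityˡ _)
    (coeffs (λ i → +-cong refl (trans (-‿distribˡ-* _ _) (sym (const-⊗ (- γ (suc m)) (D r m) i)))))

  W-D-zero : W (D r 0) (D r 1) ≈ₚ const 1#
  W-D-zero = ℙ.trans (W-one (deriv-const 1#) X) deriv-X

  W-D-suc : ∀ m → W (D r (suc m)) (D r (suc (suc m)))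
                    ≈ₚ (D r (suc m) ⊗ D r (suc m)) ⊕ (γ (suc m) · W (D r m) (D r (suc m)))
  W-D-suc m = begin
    W D₁ D₂
      ≈⟨ ℙ.sym (ℙ.*-identityˡ _) ⟩
    const 1# ⊗ W D₁ D₂
      ≈⟨ W-three-term (deriv-const 1#) (deriv-const (- γ (suc m))) (D-three-term m) ⟩
    (deriv X ⊗ (D₁ ⊗ D₁)) ⊖ (const (- γ (suc m)) ⊗ W D₀ D₁)
      ≈⟨ ℙ.+-cong (ℙ.*-cong deriv-X (ℙ.refl {D₁ ⊗ D₁}))
                  (ℙ.-‿cong (ℙ.*-cong (const-neg _) (ℙ.refl {W D₀ D₁}))) ⟩
    (const 1# ⊗ (D₁ ⊗ D₁)) ⊖ (neg (const (γ (suc m))) ⊗ W D₀ D₁)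
      ≈⟨ solve 3 (λ Q C V → con (+ 1) :* Q :- (:- C) :* V := Q :+ C :* V) ℙ.refl
                 (D₁ ⊗ D₁) (const (γ (suc m))) (W D₀ D₁) ⟩
    (D₁ ⊗ D₁) ⊕ (const (γ (suc m)) ⊗ W D₀ D₁)
      ≈⟨ ℙ.+-cong (ℙ.refl {D₁ ⊗ D₁}) (ℙ.sym (·≈const-⊗ _ _)) ⟩
    (D₁ ⊗ D₁) ⊕ (γ (suc m) · W D₀ D₁)
      ∎
    where
    open IntegerSolver ⊕-⊗-commutativeRing using (solve; _:+_; _:-_; :-_; _:*_; _:=_; con)
    open SetoidReasoning ℙ.setoid
    D₀ D₁ D₂ : Pol
    D₀ = D r m
    D₁ = D r (suc m)
    D₂ = D r (suc (suc m))

  Q : ℕ → Pol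
  Q k = D r k ⊗ D r k

  S : ℕ → Pol
  S n = sumP n (λ k → prodK (n ∸ k) (λ j → γ (suc (k +ℕ j))) · Q k)

  S-suc : ∀ n i → S (suc n) i ≈ γ (suc n) * (S n i + 1# * Q n i)
  S-suc n = sumP-suc-scaled n (λ n k → prodK (n ∸ k) (λ j → γ (suc (k +ℕ j)))) Q (γ (suc n)) 1#
              (λ k k<n → prodK-suc-∸ γ (ℕ.<⇒≤ k<n)) (prodK-suc-∸-self γ n)

  D-christoffel-darboux : ∀ m → S (suc m) ≋ (γ (suc m) · W (D r m) (D r (suc m)))
  D-christoffel-darboux zero i = begin
    S 1 i                        ≈⟨ S-suc 0 i ⟩
    γ 1 * (S 0 i + 1# * Q 0 i)   ≈⟨ *-cong refl (+-cong (const0≋0 i) (*-identityˡ _)) ⟩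
    γ 1 * (0# + Q 0 i)           ≈⟨ *-cong refl (trans (+-identityˡ _) (coeff Q₀≈W₀ i)) ⟩
    γ 1 * W (D r 0) (D r 1) i    ∎
    where
    open SetoidReasoning setoid
    Q₀≈W₀ : Q 0 ≈ₚ W (D r 0) (D r 1)
    Q₀≈W₀ = ℙ.trans (ℙ.*-identityˡ _) (ℙ.sym W-D-zero)
  D-christoffel-darboux (suc m) i = begin
    S (suc (suc m)) i                                        ≈⟨ S-suc (suc m) i ⟩
    γ (suc (suc m)) * (S (suc m) i + 1# * Q (suc m) i)       ≈⟨ *-cong refl (+-cong (D-christoffel-darboux m i)
                                                                                      (*-identityˡ _)) ⟩
    γ (suc (suc m)) * (γ (suc m) * W₀₁ i + Q (suc m) i)      ≈⟨ *-cong refl (+-comm _ _) ⟩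
    γ (suc (suc m)) * (Q (suc m) i + γ (suc m) * W₀₁ i)      ≈⟨ *-cong refl (sym (coeff (W-D-suc m) i)) ⟩
    γ (suc (suc m)) * W (D r (suc m)) (D r (suc (suc m))) i  ∎
    where
    open SetoidReasoning setoid
    W₀₁ : Pol
    W₀₁ = W (D r m) (D r (suc m))

module dPolynomials {c ℓ} (F : CharZeroField c ℓ) (r : CharZeroField.Carrier F) where
  open CharZeroField F
  open Poly F
  open PowerSeries F
  open PowerSeriesProperties F
  open BinomialPolynomials F
  open CharZeroFieldProperties F
  open WeightedSums F
  open IntegerSolver cring using (solve; _:+_; _:-_; :-_; _:*_; _:=_; con)
  open CommutativeSemigroupProperties *-commutativeSemigroup using () renaming (x∙yz≈y∙xz to x*yz≈y*xz)
  open RingProperties ring using (-0#≈0#)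

  u v : ℕ → Pol
  u k = binom (X ⊕ const (r + n̂ k)) k
  v m = binom (X ⊖ const r) m

  a b : Pol
  a = X ⊕ const (r + 1#)
  b = X ⊖ const r

  u-rec : ∀ k → ι ⊕-⊗-commutativeRing (suc k) ⊗ u (suc k) ≈ₚ (a ⊕ ι ⊕-⊗-commutativeRing k) ⊗ u k
  u-rec k = begin
    ι ⊕-⊗-commutativeRing (suc k) ⊗ u (suc k)
      ≈⟨ ℙ.*-cong (ι≈const (suc k)) (ℙ.refl {u (suc k)}) ⟩
    const (n̂ (suc k)) ⊗ u (suc k)
      ≈⟨ binom-suc-shift k shifted ⟩
    ((X ⊕ const (r + n̂ (suc k))) ⊖ const 0#) ⊗ u k
      ≈⟨ ℙ.*-cong rebase (ℙ.refl {u k}) ⟩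
    (a ⊕ const (n̂ k)) ⊗ u k
      ≈⟨ ℙ.*-cong (ℙ.+-cong (ℙ.refl {a}) (ℙ.sym (ι≈const k))) (ℙ.refl {u k}) ⟩
    (a ⊕ ι ⊕-⊗-commutativeRing k) ⊗ u k
      ∎
    where
    open SetoidReasoning ℙ.setoid
    shifted : ∀ j →
      (X ⊕ const (r + n̂ (suc k))) ⊖ const (n̂ (suc j)) ≈ₚ (X ⊕ const (r + n̂ k)) ⊖ const (n̂ j)
    shifted j = coeffs λ
      { zero    → solve 3 (λ r K J → (con (+ 0) :+ (r :+ (con (+ 1) :+ K))) :- (con (+ 1) :+ J)
                                      := (con (+ 0) :+ (r :+ K)) :- J) refl r (n̂ k) (n̂ j)
      ; (suc i) → refl }
    rebase : (X ⊕ const (r + n̂ (suc k))) ⊖ const 0# ≈ₚ a ⊕ const (n̂ k)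
    rebase = coeffs λ
      { zero    → solve 2 (λ r K → (con (+ 0) :+ (r :+ (con (+ 1) :+ K))) :- con (+ 0)
                                    := (con (+ 0) :+ (r :+ con (+ 1))) :+ K) refl r (n̂ k)
      ; (suc i) → +-cong refl -0#≈0# }

  v-rec : ∀ m → ι ⊕-⊗-commutativeRing (suc m) ⊗ v (suc m) ≈ₚ (b ⊖ ι ⊕-⊗-commutativeRing m) ⊗ v m
  v-rec m = begin
    ι ⊕-⊗-commutativeRing (suc m) ⊗ v (suc m)
      ≈⟨ ℙ.*-cong (ι≈const (suc m)) (ℙ.refl {v (suc m)}) ⟩
    const (n̂ (suc m)) ⊗ v (suc m)
      ≈⟨ binom-suc b m ⟩
    (b ⊖ const (n̂ m)) ⊗ v m
      ≈⟨ ℙ.*-cong (ℙ.+-cong (ℙ.refl {b}) (ℙ.-‿cong (ℙ.sym (ι≈const m)))) (ℙ.refl {v m}) ⟩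
    (b ⊖ ι ⊕-⊗-commutativeRing m) ⊗ v m
      ∎
    where
    open SetoidReasoning ℙ.setoid

  open Convolution.ThreeTerm ⊕-⊗-commutativeRing u v a b u-rec v-rec using (conv; conv-one; conv-three-term)
  open Wronskian ⊕-⊗-commutativeRing derivation

  d≈conv : ∀ n → d r n ≈ₚ conv n
  d≈conv n = sumP≈∑ (suc n) _

  β : ℕ → Carrier
  β n = n̂ (suc n) + (r + r)

  a⊖b⊕ι≈β : ∀ N → (a ⊖ b) ⊕ ι ⊕-⊗-commutativeRing N ≈ₚ const (β N)
  a⊖b⊕ι≈β N = ℙ.trans (ℙ.+-cong (ℙ.refl {a ⊖ b}) (ι≈const N)) (coeffs λ
    { zero    → solve 2 (λ r N → ((con (+ 0) :+ (r :+ con (+ 1))) :- (con (+ 0) :- r)) :+ N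
                                  := (con (+ 1) :+ N) :+ (r :+ r)) refl r (n̂ N)
    ; (suc i) → solve 1 (λ x → ((x :+ con (+ 0)) :- (x :- con (+ 0))) :+ con (+ 0) := con (+ 0))
                        refl (X (suc i)) })

  d-three-term : ∀ N →
    const (n̂ (suc (suc N))) ⊗ d r (suc (suc N)) ≈ₚ ((a ⊕ b) ⊗ d r (suc N)) ⊕ (const (β N) ⊗ d r N)
  d-three-term N = begin
    const (n̂ (suc (suc N))) ⊗ d r (suc (suc N))
      ≈⟨ ℙ.*-cong (ℙ.sym (ι≈const (suc (suc N)))) (d≈conv (suc (suc N))) ⟩
    ι ⊕-⊗-commutativeRing (suc (suc N)) ⊗ conv (suc (suc N))
      ≈⟨ conv-three-term N ⟩
    ((a ⊕ b) ⊗ conv (suc N)) ⊕ (((a ⊖ b) ⊕ ι ⊕-⊗-commutativeRing N) ⊗ conv N)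
      ≈⟨ ℙ.+-cong (ℙ.*-cong (ℙ.refl {a ⊕ b}) (ℙ.sym (d≈conv (suc N))))
                  (ℙ.*-cong (a⊖b⊕ι≈β N) (ℙ.sym (d≈conv N))) ⟩
    ((a ⊕ b) ⊗ d r (suc N)) ⊕ (const (β N) ⊗ d r N)
      ∎
    where open SetoidReasoning ℙ.setoid

  d-zero : d r 0 ≈ₚ const 1#
  d-zero = begin
    d r 0                   ≈⟨ d≈conv 0 ⟩
    const 0# ⊕ (u 0 ⊗ v 0)  ≈⟨ ℙ.+-identityˡ _ ⟩
    u 0 ⊗ v 0               ≈⟨ ℙ.*-cong (binom-zero (X ⊕ const (r + n̂ 0))) (binom-zero b) ⟩
    const 1# ⊗ const 1#     ≈⟨ ℙ.*-identityˡ _ ⟩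
    const 1#                ∎
    where open SetoidReasoning ℙ.setoid

  d-one : d r 1 ≈ₚ a ⊕ b
  d-one = begin
    d r 1                             ≈⟨ d≈conv 1 ⟩
    conv 1                            ≈⟨ ℙ.sym (ℙ.*-identityˡ _) ⟩
    const 1# ⊗ conv 1                 ≈⟨ ℙ.*-cong (ℙ.sym ι₁≈1) (ℙ.refl {conv 1}) ⟩
    ι ⊕-⊗-commutativeRing 1 ⊗ conv 1  ≈⟨ conv-one ⟩
    (a ⊕ b) ⊗ conv 0                  ≈⟨ ℙ.*-cong (ℙ.refl {a ⊕ b}) (ℙ.trans (ℙ.sym (d≈conv 0)) d-zero) ⟩
    (a ⊕ b) ⊗ const 1#                ≈⟨ ℙ.*-identityʳ _ ⟩
    a ⊕ b                             ∎
    where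
    open SetoidReasoning ℙ.setoid
    ι₁≈1 : ι ⊕-⊗-commutativeRing 1 ≈ₚ const 1#
    ι₁≈1 = ℙ.+-identityʳ _

  deriv-a⊕b : deriv (a ⊕ b) ≈ₚ const (n̂ 2)
  deriv-a⊕b = coeffs λ
    { zero    → solve 0 ((con (+ 1) :+ con (+ 0)) :* ((con (+ 1) :+ con (+ 0)) :+ (con (+ 1) :- con (+ 0)))
                         := con (+ 1) :+ (con (+ 1) :+ con (+ 0))) refl
    ; (suc i) → solve 1 (λ n → n :* ((con (+ 0) :+ con (+ 0)) :+ (con (+ 0) :- con (+ 0))) := con (+ 0))
                  refl (n̂ (suc (suc i))) }

  W-d-zero : W (d r 0) (d r 1) ≈ₚ const (n̂ 2)
  W-d-zero = ℙ.trans (W-cong d-zero d-one) (ℙ.trans (W-one (deriv-const 1#) (a ⊕ b)) deriv-a⊕b)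

  W-d-suc : ∀ m → (n̂ (suc (suc m)) · W (d r (suc m)) (d r (suc (suc m))))
                    ≋ ((n̂ 2 · (d r (suc m) ⊗ d r (suc m))) ⊖ (β m · W (d r m) (d r (suc m))))
  W-d-suc m i = begin
    n̂ (suc (suc m)) * W d₁ d₂ i
      ≈⟨ sym (const-⊗ _ (W d₁ d₂) i) ⟩
    (const (n̂ (suc (suc m))) ⊗ W d₁ d₂) i
      ≈⟨ coeff (W-three-term (deriv-const (n̂ (suc (suc m)))) (deriv-const (β m)) (d-three-term m)) i ⟩
    (deriv (a ⊕ b) ⊗ (d₁ ⊗ d₁)) i + - (const (β m) ⊗ W d₀ d₁) i
      ≈⟨ +-cong (coeff (ℙ.*-cong deriv-a⊕b (ℙ.refl {d₁ ⊗ d₁})) i) refl ⟩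
    (const (n̂ 2) ⊗ (d₁ ⊗ d₁)) i + - (const (β m) ⊗ W d₀ d₁) i
      ≈⟨ +-cong (const-⊗ _ (d₁ ⊗ d₁) i) (-‿cong (const-⊗ _ (W d₀ d₁) i)) ⟩
    n̂ 2 * (d₁ ⊗ d₁) i + - (β m * W d₀ d₁ i)
      ∎
    where
    open SetoidReasoning setoid
    d₀ d₁ d₂ : Pol
    d₀ = d r m
    d₁ = d r (suc m)
    d₂ = d r (suc (suc m))

  ψ : ℕ → Carrier
  ψ s = (n̂ s + (r + r)) * (n̂ s ⁻¹)

  Q : ℕ → Pol
  Q k = d r k ⊗ d r k

  T : ℕ → Pol
  T n = sumP n (λ k → (sign k * prodK (n ∸ k) (λ j → ψ (suc (k +ℕ j)))) · Q k)

  T-suc : ∀ n i → T (suc n) i ≈ ψ (suc n) * (T n i + sign n * Q n i)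
  T-suc n = sumP-suc-scaled n (λ n k → sign k * prodK (n ∸ k) (λ j → ψ (suc (k +ℕ j)))) Q (ψ (suc n)) (sign n)
    (λ k k<n → trans (*-cong refl (prodK-suc-∸ ψ (ℕ.<⇒≤ k<n))) (x*yz≈y*xz _ _ _))
    (trans (*-cong refl (prodK-suc-∸-self ψ n))
           (solve 2 (λ s p → s :* (p :* con (+ 1)) := p :* s) refl (sign n) (ψ (suc n))))

  d-christoffel-darboux : ∀ m → T (suc m) ≋ ((sign m * (β m * (n̂ 2 ⁻¹))) · W (d r m) (d r (suc m)))
  d-christoffel-darboux zero i = begin
    T 1 i                                        ≈⟨ T-suc 0 i ⟩
    ψ 1 * (T 0 i + 1# * Q 0 i)                   ≈⟨ *-cong refl (trans (+-cong (const0≋0 i) (*-identityˡ _))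
                                                                       (+-identityˡ _)) ⟩
    ψ 1 * Q 0 i                                  ≈⟨ *-cong refl (coeff Q₀≈1 i) ⟩
    ψ 1 * const 1# i                             ≈⟨ *-const _ _ i ⟩
    const (ψ 1 * 1#) i                           ≈⟨ coeff (const-cong scalars) i ⟩
    const ((1# * (β 0 * n̂ 2 ⁻¹)) * n̂ 2) i        ≈⟨ sym (*-const _ _ i) ⟩
    (1# * (β 0 * n̂ 2 ⁻¹)) * const (n̂ 2) i        ≈⟨ *-cong refl (sym (coeff W-d-zero i)) ⟩
    (1# * (β 0 * n̂ 2 ⁻¹)) * W (d r 0) (d r 1) i  ∎
    where
    open SetoidReasoning setoid
    Q₀≈1 : Q 0 ≈ₚ const 1#
    Q₀≈1 = ℙ.trans (ℙ.*-cong d-zero d-zero) (ℙ.*-identityˡ _)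
    scalars : ψ 1 * 1# ≈ (1# * (β 0 * n̂ 2 ⁻¹)) * n̂ 2
    scalars = begin
      (β 0 * n̂ 1 ⁻¹) * 1#          ≈⟨ *-cong (*-cong refl n̂1⁻¹≈1) refl ⟩
      (β 0 * 1#) * 1#              ≈⟨ solve 1 (λ x → (x :* con (+ 1)) :* con (+ 1) := x :* con (+ 1)) refl (β 0) ⟩
      β 0 * 1#                     ≈⟨ *-cong refl (sym (⁻¹-inverseˡ (char0 1))) ⟩
      β 0 * (n̂ 2 ⁻¹ * n̂ 2)         ≈⟨ solve 3 (λ x h t → x :* (h :* t) := (con (+ 1) :* (x :* h)) :* t)
                                            refl (β 0) (n̂ 2 ⁻¹) (n̂ 2) ⟩
      (1# * (β 0 * n̂ 2 ⁻¹)) * n̂ 2  ∎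
  d-christoffel-darboux (suc m) i = begin
    T (suc (suc m)) i
      ≈⟨ T-suc (suc m) i ⟩
    (β′ * A ⁻¹) * (T (suc m) i + - s * Q₁)
      ≈⟨ *-cong refl (+-cong (d-christoffel-darboux m i) (*-cong refl (sym (*-identityˡ Q₁)))) ⟩
    (β′ * A ⁻¹) * ((s * (β m * h)) * W₀₁ + - s * (1# * Q₁))
      ≈⟨ *-cong refl (+-cong refl (*-cong refl (*-cong (sym (⁻¹-inverseˡ (char0 1))) refl))) ⟩
    (β′ * A ⁻¹) * ((s * (β m * h)) * W₀₁ + - s * ((h * n̂ 2) * Q₁))
      ≈⟨ solve 8 (λ β′ A′ s β h W t Q → (β′ :* A′) :* ((s :* (β :* h)) :* W :+ (:- s) :* ((h :* t) :* Q))
                                        := (:- s :* (β′ :* h)) :* (A′ :* (t :* Q :+ :- (β :* W))))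
                 refl β′ (A ⁻¹) s (β m) h W₀₁ (n̂ 2) Q₁ ⟩
    (- s * (β′ * h)) * (A ⁻¹ * (n̂ 2 * Q₁ + - (β m * W₀₁)))
      ≈⟨ *-cong refl (*-cong refl (sym (W-d-suc m i))) ⟩
    (- s * (β′ * h)) * (A ⁻¹ * (A * W₁₂))
      ≈⟨ *-cong refl (trans (sym (*-assoc _ _ _)) (*-cong (⁻¹-inverseˡ (char0 (suc m))) refl)) ⟩
    (- s * (β′ * h)) * (1# * W₁₂)
      ≈⟨ *-cong refl (*-identityˡ _) ⟩
    (- s * (β′ * h)) * W₁₂
      ∎
    where
    open SetoidReasoning setoid
    A β′ h s W₀₁ W₁₂ Q₁ : Carrier
    A   = n̂ (suc (suc m))
    β′  = β (suc m)
    h   = n̂ 2 ⁻¹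
    s   = sign m
    W₀₁ = W (d r m) (d r (suc m)) i
    W₁₂ = W (d r (suc m)) (d r (suc (suc m))) i
    Q₁  = Q (suc m) i

theorem3p2 : ∀ {c ℓ} (F : CharZeroField c ℓ) → let open CharZeroField F in let open Poly F in
  (r : Carrier) (n : ℕ) → 1 ≤ n →
    (sumP n (λ k → prodK (n ∸ k) (λ j → n̂ (suc (k +ℕ j)) * (n̂ (suc (k +ℕ j)) + (r + r)))
                     · (D r k ⊗ D r k))
      ≋ ((n̂ n * (n̂ n + (r + r)))
           · ((D r (n ∸ 1) ⊗ deriv (D r n)) ⊖ (D r n ⊗ deriv (D r (n ∸ 1))))))
    ×
    (sumP n (λ k → (sign k * prodK (n ∸ k)
                       (λ j → (n̂ (suc (k +ℕ j)) + (r + r)) * (n̂ (suc (k +ℕ j)) ⁻¹)))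
                     · (d r k ⊗ d r k))
      ≋ ((sign (n ∸ 1) * ((n̂ n + (r + r)) * (n̂ 2 ⁻¹)))
           · ((d r (n ∸ 1) ⊗ deriv (d r n)) ⊖ (d r n ⊗ deriv (d r (n ∸ 1))))))
theorem3p2 F r (suc m) _ = DPolynomials.D-christoffel-darboux F r m , dPolynomials.d-christoffel-darboux F r m
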